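{- Let $k\ge 1$. Let $\mathcal{H}$ be the bi-hypergraph obtained from $\mathcal{H}_{2k}$ by removing the edge $\{v_{2k,1},v_{2k,2},v_{2k,3}\}$ and adding the edges $\{v_{1,j},v_{2k,j+1},v_{2k,j+2}\}$ for all $j\in\{1,2,3\}$ (second indices taken modulo $3$ in $\{1,2,3\}$). Then $\mathcal{H}$ is minimal uncolorable.
   Context: A bi-hypergraph is a pair $(\mathcal{V},\mathcal{E})$ with $\mathcal{V}$ a finite set and $\mathcal{E}$ a family of subsets of $\mathcal{V}$ (edges). A proper coloring is a map $f:\mathcal{V}\to\mathbb{N}$ with $1<|\{f(v):v\in e\}|<|e|$ for every edge $e$; a bi-hypergraph is colorable if such $f$ exists. A subhypergraph is $(\mathcal{V}',\mathcal{E}')$ with $\mathcal{V}'\subseteq\mathcal{V}$, $\mathcal{E}'\subseteq\mathcal{E}$; a bi-hypergraph is minimal uncolorable if it is uncolorable but each of its proper subhypergraphs is colorable. For $k\ge 2$, let $V_i=\{v_{i,1},v_{i,2},v_{i,3}\}$ ($i\in[k]$) be pairwise disjoint sets, and write $v_{i,4}=v_{i,1}$, $v_{i,5}=v_{i,2}$. The bi-hypergraph $\mathcal{H}_k$ has vertex set $V_1\cup\cdots\cup V_k$ and edge set consisting of the edges $V_i$ for all $i\in[k]$, together with the edges $\{v_{q+1,j},v_{q,j},v_{q,j+t}\}$ for all $q\in[k-1]$, $j\in\{1,2,3\}$, $t\in\{1,2\}$. (Thus $\mathcal{H}_k$ has $3k$ vertices and $7k-6$ edges.) -}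

module Defs where

open import Data.Nat using (ℕ; zero; suc; _<_; _*_; _∸_)
open import Data.Nat.Properties using (_≟_)
open import Data.Fin using (Fin; zero; suc; inject₁; fromℕ; combine)
open import Data.Fin.Subset using (Subset; ⁅_⁆; _∪_; ∣_∣; _⊆_; _∈_; ⊤)
open import Data.Fin.Subset.Properties using (_∈?_)
open import Data.List using (List; []; _∷_; length; map; filter; deduplicate; concatMap; _++_; lookup)
open import Data.List.Base using (allFin)
open import Data.Product using (_×_; Σ; ∃)
open import Relation.Binary.PropositionalEquality using (_≡_)
open import Relation.Nullary using (¬_)

record BiHypergraph (n : ℕ) : Set where
  field
    edges : List (Subset n)

  edge : Fin (length edges) → Subset n
  edge = lookup edges

open BiHypergraph public

members : {n : ℕ} → Subset n → List (Fin n)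
members e = filter (λ v → v ∈? e) (allFin _)

numColours : {n : ℕ} → (Fin n → ℕ) → Subset n → ℕ
numColours f e = length (deduplicate _≟_ (map f (members e)))

ProperOnEdge : {n : ℕ} → (Fin n → ℕ) → Subset n → Set
ProperOnEdge f e = (1 < numColours f e) × (numColours f e < ∣ e ∣)

record SubHypergraph {n : ℕ} (H : BiHypergraph n) : Set where
  field
    verts  : Subset n
    edgeIx : Subset (length (edges H))
    wf     : ∀ i → i ∈ edgeIx → edge H i ⊆ verts

open SubHypergraph public

IsWhole : {n : ℕ} {H : BiHypergraph n} → SubHypergraph H → Set
IsWhole S = (verts S ≡ ⊤) × (edgeIx S ≡ ⊤)

-- A colouring of a subhypergraph is a map from its vertex set to ℕ; since
-- all its edges lie inside verts S, we may equivalently take maps defined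
-- on all of Fin n (values outside verts S are irrelevant).
SubColourable : {n : ℕ} {H : BiHypergraph n} → SubHypergraph H → Set
SubColourable {n} {H} S =
  Σ (Fin n → ℕ) λ f → ∀ i → i ∈ edgeIx S → ProperOnEdge f (edge H i)

Colourable : {n : ℕ} → BiHypergraph n → Set
Colourable {n} H = Σ (Fin n → ℕ) λ f → ∀ i → ProperOnEdge f (edge H i)

MinimalUncolourable : {n : ℕ} → BiHypergraph n → Set
MinimalUncolourable H =
  (¬ Colourable H) × (∀ (S : SubHypergraph H) → ¬ IsWhole S → SubColourable S)

-- The bi-hypergraph of Lemma 4.1.  Parameter m: there are K = suc m
-- blocks V_1, …, V_K (block index i ∈ Fin K corresponds to V_{i+1}),
-- and v_{i,j} (j ∈ Fin 3 standing for 1,2,3) is the vertex combine i j.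

next3 : Fin 3 → Fin 3
next3 zero = suc zero
next3 (suc zero) = suc (suc zero)
next3 (suc (suc zero)) = zero

triple : {n : ℕ} → Fin n → Fin n → Fin n → Subset n
triple a b c = ⁅ a ⁆ ∪ (⁅ b ⁆ ∪ ⁅ c ⁆)

module Construction (m : ℕ) where
  K : ℕ
  K = suc m

  v : Fin K → Fin 3 → Fin (K * 3)
  v i j = combine i j

  block : Fin K → Subset (K * 3)
  block i = triple (v i zero) (v i (suc zero)) (v i (suc (suc zero)))

  lastBlock : Fin K
  lastBlock = fromℕ m

  -- the edges V_i for all blocks except the last one V_K
  blockEdges : List (Subset (K * 3))
  blockEdges = map (λ q → block (inject₁ q)) (allFin m)

  linkEdges : List (Subset (K * 3))
  linkEdges =
    concatMap (λ q → concatMap (λ j →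
        triple (v (suc q) j) (v (inject₁ q) j) (v (inject₁ q) (next3 j))
      ∷ triple (v (suc q) j) (v (inject₁ q) j) (v (inject₁ q) (next3 (next3 j)))
      ∷ []) (allFin 3)) (allFin m)

  closingEdges : List (Subset (K * 3))
  closingEdges =
    map (λ j → triple (v zero j) (v lastBlock (next3 j)) (v lastBlock (next3 (next3 j))))
        (allFin 3)

  H : BiHypergraph (K * 3)
  H = record { edges = blockEdges ++ linkEdges ++ closingEdges }

Hlemma : (k : ℕ) → BiHypergraph (suc (2 * k ∸ 1) * 3)
Hlemma k = Construction.H (2 * k ∸ 1)

-- A proper colouring uses exactly two colours on every edge; read each block as a row of three colours.
-- If a row has colour B at position j and A ≠ B at the other two, the six link edges to the next row
-- force B at its positions j+1 and j+2 and leave only A or B at j, and the block edge of the next row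
-- then forces A there: the pattern moves on with its colours swapped. V_1, being two-coloured, carries
-- such a pattern, and after the odd number 2k−1 of steps to V_2k (which has no block edge) the closing
-- edge {v_1j, v_2k,j+1, v_2k,j+2} sees only B. Every edge can be dropped: without the closing edge at j,
-- let every row carry the pattern at j with colours 0, 1 alternating; without the link edge
-- {v_q+1,j, v_qj, v_q,j+t}, move the pattern from j−t to j after row q; without the block edge of V_σ,
-- alternate 0, 1 before V_σ, make V_σ constant, alternate 2, 3 after it and paint the last block 3.

module Submission where

open import Defs
open import Data.Bool using (Bool; true; false; not; if_then_else_; _xor_)
open import Data.Bool.Properties using (not-injective) renaming (_≟_ to _≟ᵇ_)
open import Data.Empty using (⊥; ⊥-elim)
open import Data.Fin using (Fin; zero; suc; toℕ; inject₁; fromℕ<; remQuot; cast)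
open import Data.Fin.Properties
  using (all?; ¬∀⟶∃¬; toℕ-injective; toℕ<n; toℕ-cast; toℕ-inject₁; toℕ-fromℕ; toℕ-fromℕ<; fromℕ<-cong;
         fromℕ<-toℕ; combine-injectiveˡ; combine-injectiveʳ; remQuot-combine; combine-remQuot)
  renaming (_≟_ to _≟ᶠ_)
open import Data.Fin.Subset as Subset using (Subset; ∣_∣; inside; outside)
open import Data.Fin.Subset.Properties using (_∈?_; ∪⇔⊎; x∈⁅y⁆⇔x≡y; x∈⁅x⁆; x∈p∪q⁺; ⊆-antisym; ⊆⊤)
open import Data.List using (List; []; _∷_; _++_; length; map; filter; deduplicate; lookup; tabulate; allFin;
                             concatMap; cartesianProduct; cartesianProductWith)
open import Data.List.Properties using (length-map; map-++; map-∘)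
open import Data.List.Membership.Propositional using (_∈_)
open import Data.List.Membership.Propositional.Properties
  using (∈-filter⁺; ∈-filter⁻; ∈-allFin; ∈-lookup; ∈-map⁺; ∈-map⁻; ∈-++⁺ˡ; ∈-++⁺ʳ; ∈-++⁻;
         ∈-cartesianProductWith⁺; ∈-cartesianProductWith⁻; ∈-cartesianProduct⁺; deduplicate-∈⇔)
open import Data.List.Membership.Propositional.Properties.WithK using (unique∧set⇒bag)
open import Data.List.Relation.Binary.BagAndSetEquality using (_∼[_]_; set; ∼bag⇒↭; map-cong)
open import Data.List.Relation.Binary.Permutation.Propositional.Properties using (↭-length)
open import Data.List.Relation.Unary.All using ([]; _∷_)
open import Data.List.Relation.Unary.AllPairs using ([]; _∷_)
open import Data.List.Relation.Unary.Any using (here; there; index)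
open import Data.List.Relation.Unary.Any.Properties using (lookup-index)
open import Data.List.Relation.Unary.Unique.Propositional using (Unique)
open import Data.List.Relation.Unary.Unique.Propositional.Properties
  using (Unique[x∷xs]⇒x∉xs; filter⁺; allFin⁺; map⁺; ++⁺; cartesianProductWith⁺; cartesianProduct⁺)
open import Data.List.Relation.Unary.Unique.DecPropositional.Properties using (deduplicate-!)
open import Data.Nat using (ℕ; zero; suc; _+_; _*_; _∸_; _⊓_; _<_; _≤_; z≤n; s≤s; s≤s⁻¹)
open import Data.Nat.Properties
  using (_≟_; _≤?_; _<?_; ≤-refl; ≤-reflexive; <⇒≤; <-trans; n<1+n; m<n⇒m<1+n; <⇒≱; <⇒≯; >⇒≢; n≮n;
         <-cmp; m≤n⇒m<n∨m≡n; +-suc; +-mono-≤; suc-injective; 1+n≢n; m⊓n≤n; m≤n⇒m⊓n≡m; ≤⇒≯; <-≤-trans; +-identityʳ)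
open import Data.Product using (Σ; ∃; ∃₂; _×_; _,_; proj₁; proj₂; uncurry)
open import Data.Sum using (_⊎_; inj₁; inj₂; fromInj₂)
open import Data.Sum.Function.Propositional using (_⊎-cong_)
open import Data.Vec using ([]; _∷_)
open import Function using (_∘_; const; _⇔_; mk⇔; Equivalence)
import Function.Properties.Equivalence as ⇔
open import Relation.Binary.Definitions using (tri<; tri≈; tri>)
open import Relation.Binary.PropositionalEquality
  using (_≡_; _≢_; refl; sym; trans; cong; cong₂; subst; subst₂; module ≡-Reasoning)
open import Relation.Nullary using (¬_; ¬?; Dec; does; yes; no; map′)
open import Relation.Nullary.Decidable using (from-yes; dec-true; dec-false; _×-dec_; _⊎-dec_; _→-dec_)
open import Relation.Unary using (Decidable)

private
  variable
    A B C D : Set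
    n : ℕ
    xs ys : List A

unique∧set⇒length≡ : Unique xs → Unique ys → xs ∼[ set ] ys → length xs ≡ length ys
unique∧set⇒length≡ u v xs≈ys = ↭-length (∼bag⇒↭ (unique∧set⇒bag u v xs≈ys))

∈-[_,_,_] : ∀ {w} (x y z : A) → w ∈ x ∷ y ∷ z ∷ [] ⇔ (w ≡ x ⊎ w ≡ y ⊎ w ≡ z)
∈-[ x , y , z ] = mk⇔
  (λ { (here p) → inj₁ p ; (there (here p)) → inj₂ (inj₁ p) ; (there (there (here p))) → inj₂ (inj₂ p) })
  (λ { (inj₁ p) → here p ; (inj₂ (inj₁ p)) → there (here p) ; (inj₂ (inj₂ p)) → there (there (here p)) })

∈⇒lookup : ∀ {x} → x ∈ xs → ∃ λ i → lookup xs i ≡ x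
∈⇒lookup x∈xs = index x∈xs , sym (lookup-index x∈xs)

lookup-map : (f : A → B) (xs : List A) (i : Fin (length (map f xs))) →
             lookup (map f xs) i ≡ f (lookup xs (cast (length-map f xs) i))
lookup-map f (x ∷ xs) zero    = refl
lookup-map f (x ∷ xs) (suc i) = lookup-map f xs i

lookup-injective : Unique xs → ∀ {i j} → lookup xs i ≡ lookup xs j → i ≡ j
lookup-injective {xs = _ ∷ _}  _       {zero}  {zero}  _ = refl
lookup-injective {xs = _ ∷ xs} u       {zero}  {suc j} e =
  ⊥-elim (Unique[x∷xs]⇒x∉xs u (subst (_∈ xs) (sym e) (∈-lookup j)))
lookup-injective {xs = _ ∷ xs} u       {suc i} {zero}  e =
  ⊥-elim (Unique[x∷xs]⇒x∉xs u (subst (_∈ xs) e (∈-lookup i)))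
lookup-injective               (_ ∷ u) {suc i} {suc j} e = cong suc (lookup-injective u e)

cast-injective : ∀ {m k} .(eq : m ≡ k) {i j : Fin m} → cast eq i ≡ cast eq j → i ≡ j
cast-injective eq {i} {j} e = toℕ-injective (trans (sym (toℕ-cast eq i)) (trans (cong toℕ e) (toℕ-cast eq j)))

concatMap-cartesianProductWith : (g : B → C) (h : A → D → B) (ys : List D) {f : A → List C} →
  (∀ x → f x ≡ map g (map (h x) ys)) → ∀ xs → concatMap f xs ≡ map g (cartesianProductWith h xs ys)
concatMap-cartesianProductWith g h ys f≡ []       = refl
concatMap-cartesianProductWith g h ys f≡ (x ∷ xs) =
  trans (cong₂ _++_ (f≡ x) (concatMap-cartesianProductWith g h ys f≡ xs))
        (sym (map-++ g (map (h x) ys) (cartesianProductWith h xs ys)))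

except-lookup-map : (f : A → B) (P : C → B → Set) → Unique xs →
             (∀ x → Σ C λ c → ∀ y → y ≢ x → P c (f y)) →
             ∀ i → Σ C λ c → ∀ i′ → i′ ≢ i → P c (lookup (map f xs) i′)
except-lookup-map {xs = xs} f P u good i with good (lookup xs (cast (length-map f xs) i))
... | c , ok = c , λ i′ i′≢i →
  subst (P c) (sym (lookup-map f xs i′)) (ok _ (i′≢i ∘ cast-injective (length-map f xs) ∘ lookup-injective u))

-- Two-coloured triples

distinct : List ℕ → ℕ
distinct xs = length (deduplicate _≟_ xs)

distinct-cong : xs ∼[ set ] ys → distinct xs ≡ distinct ys
distinct-cong xs≈ys = unique∧set⇒length≡ (deduplicate-! _≟_ _) (deduplicate-! _≟_ _)
  (⇔.trans (⇔.sym (deduplicate-∈⇔ _≟_)) (⇔.trans xs≈ys (deduplicate-∈⇔ _≟_)))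

distinct-unique : Unique xs → distinct xs ≡ length xs
distinct-unique u = unique∧set⇒length≡ (deduplicate-! _≟_ _) u (⇔.sym (deduplicate-∈⇔ _≟_))

∈-members : ∀ {w} (e : Subset n) → w ∈ members e ⇔ w Subset.∈ e
∈-members e = mk⇔ (proj₂ ∘ ∈-filter⁻ (_∈? e) {xs = allFin _}) (∈-filter⁺ (_∈? e) (∈-allFin _))

length-filter-tabulate : ∀ {P : A → Set} (P? : Decidable P) (e : Subset n) (h : Fin n → A) →
                         (∀ i → does (P? (h i)) ≡ does (i ∈? e)) → length (filter P? (tabulate h)) ≡ ∣ e ∣
length-filter-tabulate P? []           h same = refl
length-filter-tabulate P? (inside ∷ e) h same with does (P? (h zero)) | same zero
... | true  | _ = cong suc (length-filter-tabulate P? e (h ∘ suc) (same ∘ suc))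
length-filter-tabulate P? (outside ∷ e) h same with does (P? (h zero)) | same zero
... | false | _ = length-filter-tabulate P? e (h ∘ suc) (same ∘ suc)

length-members : (e : Subset n) → length (members e) ≡ ∣ e ∣
length-members e = length-filter-tabulate (_∈? e) e (λ i → i) (λ _ → refl)

members-triple : (x y z : Fin n) → members (triple x y z) ∼[ set ] x ∷ y ∷ z ∷ []
members-triple x y z = ⇔.trans (∈-members (triple x y z))
  (⇔.trans ∪⇔⊎ (⇔.trans (x∈⁅y⁆⇔x≡y ⊎-cong ⇔.trans ∪⇔⊎ (x∈⁅y⁆⇔x≡y ⊎-cong x∈⁅y⁆⇔x≡y)) (⇔.sym ∈-[ x , y , z ])))

∣triple∣≡3 : {x y z : Fin n} → x ≢ y → x ≢ z → y ≢ z → ∣ triple x y z ∣ ≡ 3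
∣triple∣≡3 {x = x} {y} {z} x≢y x≢z y≢z = trans (sym (length-members (triple x y z)))
  (unique∧set⇒length≡ (filter⁺ (_∈? triple x y z) (allFin⁺ _)) ((x≢y ∷ x≢z ∷ []) ∷ (y≢z ∷ []) ∷ [] ∷ [])
                      (members-triple x y z))

numColours-triple : (f : Fin n → ℕ) (x y z : Fin n) → numColours f (triple x y z) ≡ distinct (f x ∷ f y ∷ f z ∷ [])
numColours-triple f x y z = distinct-cong (map-cong (λ _ → refl) (members-triple x y z))

-- A record rather than a definition, so that a, b, c can be inferred by unification.
record Bichromatic (a b c : ℕ) : Set where
  constructor bichromatic
  field
    distinct≡2 : distinct (a ∷ b ∷ c ∷ []) ≡ 2

bichromatic? : ∀ a b c → Dec (Bichromatic a b c)
bichromatic? a b c = map′ bichromatic Bichromatic.distinct≡2 (distinct (a ∷ b ∷ c ∷ []) ≟ 2)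

bichromatic-cong : ∀ {a b c a′ b′ c′} → a ≡ a′ → b ≡ b′ → c ≡ c′ → Bichromatic a b c ⇔ Bichromatic a′ b′ c′
bichromatic-cong refl refl refl = ⇔.refl

1<k<3⇔k≡2 : ∀ {k} → (1 < k × k < 3) ⇔ k ≡ 2
1<k<3⇔k≡2 = mk⇔ (λ { (s≤s (s≤s z≤n) , s≤s (s≤s (s≤s z≤n))) → refl })
                 (λ { refl → s≤s (s≤s z≤n) , s≤s (s≤s (s≤s z≤n)) })

properOnTriple⇔ : (f : Fin n → ℕ) {x y z : Fin n} → x ≢ y → x ≢ z → y ≢ z →
                  ProperOnEdge f (triple x y z) ⇔ Bichromatic (f x) (f y) (f z)
properOnTriple⇔ f {x} {y} {z} x≢y x≢z y≢z =
  subst₂ (λ k size → (1 < k × k < size) ⇔ Bichromatic (f x) (f y) (f z))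
         (sym (numColours-triple f x y z)) (sym (∣triple∣≡3 x≢y x≢z y≢z))
         (⇔.trans 1<k<3⇔k≡2 (mk⇔ bichromatic Bichromatic.distinct≡2))

¬bichromatic-constant : ∀ {a} → ¬ Bichromatic a a a
¬bichromatic-constant {a} (bichromatic two) = 1≢2 (trans (sym (distinct-cong aaa≈a)) two)
  where
  1≢2 : 1 ≢ 2
  1≢2 ()
  aaa≈a : a ∷ a ∷ a ∷ [] ∼[ set ] a ∷ []
  aaa≈a = mk⇔ (λ { (here p) → here p ; (there (here p)) → here p ; (there (there (here p))) → here p })
              (λ { (here p) → here p })

¬bichromatic-equal : ∀ {a b c} → a ≡ b → b ≡ c → ¬ Bichromatic a b c
¬bichromatic-equal refl refl = ¬bichromatic-constant

bichromatic⇒∈ : ∀ {x a b} → Bichromatic x a b → a ≢ b → x ≡ a ⊎ x ≡ b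
bichromatic⇒∈ {x} {a} {b} (bichromatic two) a≢b with x ≟ a | x ≟ b
... | yes x≡a | _       = inj₁ x≡a
... | no _    | yes x≡b = inj₂ x≡b
... | no x≢a  | no x≢b  with () ← trans (sym (distinct-unique ((x≢a ∷ x≢b ∷ []) ∷ (a≢b ∷ []) ∷ [] ∷ []))) two

-- Without isolated vertices, a subhypergraph that keeps every edge is the whole hypergraph.
minimalUncolourable-intro : {H : BiHypergraph n} → ¬ Colourable H →
  (∀ x → ∃ λ i → x Subset.∈ edge H i) →
  (∀ i₀ → Σ (Fin n → ℕ) λ f → ∀ i → i ≢ i₀ → ProperOnEdge f (edge H i)) →
  MinimalUncolourable H
minimalUncolourable-intro {H = H} uncolourable covered critical = uncolourable , minimal
  where
  minimal : (S : SubHypergraph H) → ¬ IsWhole S → SubColourable S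
  minimal S notWhole with all? (_∈? edgeIx S)
  ... | yes allEdges = ⊥-elim (notWhole (⊆-antisym ⊆⊤ (λ {x} _ → inVerts x) , ⊆-antisym ⊆⊤ (λ {i} _ → allEdges i)))
    where
    inVerts : ∀ x → x Subset.∈ verts S
    inVerts x with covered x
    ... | i , x∈eᵢ = wf S i (allEdges i) x∈eᵢ
  ... | no notAll with ¬∀⟶∃¬ _ _ (_∈? edgeIx S) notAll
  ... | i₀ , i₀∉S with critical i₀
  ... | f , proper = f , λ i i∈S → proper i λ { refl → i₀∉S i∈S }

-- Rows: the colours of one block

Row : Set
Row = Fin 3 → ℕ

advance : Bool → Fin 3 → Fin 3
advance false j = next3 j
advance true  j = next3 (next3 j)

next3³ : ∀ j → next3 (next3 (next3 j)) ≡ j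
next3³ zero             = refl
next3³ (suc zero)       = refl
next3³ (suc (suc zero)) = refl

BichromaticRow : Row → Set
BichromaticRow r = Bichromatic (r zero) (r (suc zero)) (r (suc (suc zero)))

LinkOk : Row → Row → Fin 3 → Bool → Set
LinkOk r r′ j s = Bichromatic (r′ j) (r j) (r (advance s j))

Linked : Row → Row → Set
Linked r r′ = ∀ j s → LinkOk r r′ j s

ClosingOk : Row → Row → Fin 3 → Set
ClosingOk r₀ r j = Bichromatic (r₀ j) (r (next3 j)) (r (next3 (next3 j)))

Spike : Row → Fin 3 → ℕ → ℕ → Set
Spike r j A B = r j ≡ B × r (next3 j) ≡ A × r (next3 (next3 j)) ≡ A × A ≢ B

bichromaticRow-¬constant : ∀ {r B} → BichromaticRow r → ∀ j →
                           r j ≡ B → r (next3 j) ≡ B → r (next3 (next3 j)) ≡ B → ⊥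
bichromaticRow-¬constant h zero             p q s = ¬bichromatic-equal (trans p (sym q)) (trans q (sym s)) h
bichromaticRow-¬constant h (suc zero)       p q s = ¬bichromatic-equal (trans s (sym p)) (trans p (sym q)) h
bichromaticRow-¬constant h (suc (suc zero)) p q s = ¬bichromatic-equal (trans q (sym s)) (trans s (sym p)) h

bichromaticRow⇒spike : ∀ {r} → BichromaticRow r → ∃ λ j → ∃₂ λ A B → Spike r j A B
bichromaticRow⇒spike {r} h with r zero ≟ r (suc zero) | r (suc zero) ≟ r (suc (suc zero))
... | yes r₀≡r₁ | yes r₁≡r₂ = ⊥-elim (¬bichromatic-equal r₀≡r₁ r₁≡r₂ h)
... | yes r₀≡r₁ | no  r₁≢r₂ =
  suc (suc zero) , r zero , r (suc (suc zero)) , refl , refl , sym r₀≡r₁ , r₁≢r₂ ∘ trans (sym r₀≡r₁)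
... | no  r₀≢r₁ | yes r₁≡r₂ = zero , r (suc zero) , r zero , refl , refl , sym r₁≡r₂ , r₀≢r₁ ∘ sym
... | no  r₀≢r₁ | no  r₁≢r₂ with bichromatic⇒∈ h r₁≢r₂
...   | inj₁ r₀≡r₁ = ⊥-elim (r₀≢r₁ r₀≡r₁)
...   | inj₂ r₀≡r₂ = suc zero , r zero , r (suc zero) , refl , sym r₀≡r₂ , refl , r₀≢r₁

bichromatic-forced : ∀ {x A B} → Bichromatic x A A → Bichromatic x A B → A ≢ B → x ≡ B
bichromatic-forced xAA xAB A≢B with bichromatic⇒∈ xAB A≢B
... | inj₁ x≡A = ⊥-elim (¬bichromatic-equal x≡A refl xAA)
... | inj₂ x≡B = x≡B

linked-spike : ∀ {r r′ j A B} → Linked r r′ → Spike r j A B →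
               r′ (next3 j) ≡ B × r′ (next3 (next3 j)) ≡ B × (r′ j ≡ A ⊎ r′ j ≡ B)
linked-spike {r} {r′} {j} {A} {B} linked (r₀≡B , r₁≡A , r₂≡A , A≢B) = r′₁≡B , r′₂≡B , r′₀∈
  where
  r₃≡B : r (next3 (next3 (next3 j))) ≡ B
  r₃≡B = trans (cong r (next3³ j)) r₀≡B
  r₄≡A : r (next3 (next3 (next3 (next3 j)))) ≡ A
  r₄≡A = trans (cong (r ∘ next3) (next3³ j)) r₁≡A
  r′₁≡B : r′ (next3 j) ≡ B
  r′₁≡B = bichromatic-forced (subst₂ (Bichromatic _) r₁≡A r₂≡A (linked (next3 j) false))
                 (subst₂ (Bichromatic _) r₁≡A r₃≡B (linked (next3 j) true)) A≢B
  r′₂≡B : r′ (next3 (next3 j)) ≡ B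
  r′₂≡B = bichromatic-forced (subst₂ (Bichromatic _) r₂≡A r₄≡A (linked (next3 (next3 j)) true))
                 (subst₂ (Bichromatic _) r₂≡A r₃≡B (linked (next3 (next3 j)) false)) A≢B
  r′₀∈ : r′ j ≡ A ⊎ r′ j ≡ B
  r′₀∈ with bichromatic⇒∈ (subst₂ (Bichromatic _) r₀≡B r₁≡A (linked j false)) (A≢B ∘ sym)
  ... | inj₁ r′₀≡B = inj₂ r′₀≡B
  ... | inj₂ r′₀≡A = inj₁ r′₀≡A

linked-spike-swap : ∀ {r r′ j A B} → BichromaticRow r′ → Linked r r′ → Spike r j A B → Spike r′ j B A
linked-spike-swap {r′ = r′} {j = j} two linked spikeᵣ@(_ , _ , _ , A≢B) with linked-spike linked spikeᵣ
... | r′₁≡B , r′₂≡B , inj₁ r′₀≡A = r′₀≡A , r′₁≡B , r′₂≡B , A≢B ∘ sym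
... | r′₁≡B , r′₂≡B , inj₂ r′₀≡B = ⊥-elim (bichromaticRow-¬constant {r′} two j r′₀≡B r′₁≡B r′₂≡B)

module _ (k : ℕ) (c : ℕ → Row)
         (blocks : ∀ {t} → t < suc (k + k) → BichromaticRow (c t))
         (links  : ∀ {t} → t < suc (k + k) → Linked (c t) (c (suc t))) where

  spike-step₂ : ∀ {t j A B} → suc (suc t) < suc (k + k) → Spike (c t) j A B → Spike (c (suc (suc t))) j A B
  spike-step₂ 2+t<m spikeₜ = linked-spike-swap (blocks 2+t<m) (links 1+t<m)
                              (linked-spike-swap (blocks 1+t<m) (links (<-trans (n<1+n _) 1+t<m)) spikeₜ)
    where 1+t<m = <-trans (n<1+n _) 2+t<m

  spike-even : ∀ {j A B} → Spike (c 0) j A B → ∀ i → i ≤ k → Spike (c (i + i)) j A B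
  spike-even spike₀ zero    _     = spike₀
  spike-even spike₀ (suc i) 1+i≤k rewrite +-suc i i =
    spike-step₂ (s≤s (subst (_≤ k + k) (cong suc (+-suc i i)) (+-mono-≤ 1+i≤k 1+i≤k)))
                (spike-even spike₀ i (<⇒≤ 1+i≤k))

  chain-uncolourable : ¬ (∀ j → ClosingOk (c 0) (c (suc (k + k))) j)
  chain-uncolourable closing with bichromaticRow⇒spike (blocks (s≤s z≤n))
  ... | j , A , B , spike₀ with linked-spike (links ≤-refl) (spike-even spike₀ k ≤-refl)
  ... | r₁≡B , r₂≡B , _ = ¬bichromatic-equal (trans (proj₁ spike₀) (sym r₁≡B)) (trans r₁≡B (sym r₂≡B)) (closing j)

-- Facts about finitely many concrete rows, decided by evaluation

all-Bool? : {P : Bool → Set} → (∀ b → Dec (P b)) → Dec (∀ b → P b)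
all-Bool? P? = map′ (λ { (f , t) false → f ; (f , t) true → t }) (λ h → h false , h true) (P? false ×-dec P? true)

bichromaticRow? : ∀ r → Dec (BichromaticRow r)
bichromaticRow? r = bichromatic? (r zero) (r (suc zero)) (r (suc (suc zero)))

linkOk? : ∀ r r′ j s → Dec (LinkOk r r′ j s)
linkOk? r r′ j s = bichromatic? (r′ j) (r j) (r (advance s j))

linked? : ∀ r r′ → Dec (Linked r r′)
linked? r r′ = all? λ j → all-Bool? λ s → linkOk? r r′ j s

closingOk? : ∀ r₀ r j → Dec (ClosingOk r₀ r j)
closingOk? r₀ r j = bichromatic? (r₀ j) (r (next3 j)) (r (next3 (next3 j)))

advance-≢ : ∀ s j → advance s j ≢ j
advance-≢ = from-yes (all-Bool? λ s → all? λ j → ¬? (advance s j ≟ᶠ j))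

advance-injective : ∀ j s s′ → advance s j ≡ advance s′ j → s ≡ s′
advance-injective = from-yes (all? λ j → all-Bool? λ s → all-Bool? λ s′ → advance s j ≟ᶠ advance s′ j →-dec s ≟ᵇ s′)

odd : ℕ → Bool
odd zero    = false
odd (suc t) = not (odd t)

odd-double : ∀ k → odd (k + k) ≡ false
odd-double zero = refl
odd-double (suc k) rewrite +-suc k k | odd-double k = refl

bit : Bool → ℕ
bit b = if b then 1 else 0

spikeRow : Bool → Fin 3 → Row
spikeRow b p i = bit (does (i ≟ᶠ p) xor b)

spikeRow₂₃ : Bool → Row
spikeRow₂₃ b i = 2 + spikeRow b zero i

spikeRow-bichromatic : ∀ b p → BichromaticRow (spikeRow b p)
spikeRow-bichromatic = from-yes (all-Bool? λ b → all? λ p → bichromaticRow? (spikeRow b p))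

spikeRow-linked : ∀ b p → Linked (spikeRow b p) (spikeRow (not b) p)
spikeRow-linked = from-yes (all-Bool? λ b → all? λ p → linked? (spikeRow b p) (spikeRow (not b) p))

spikeRow-linkOk : ∀ b p p′ j s → (p′ ≡ j × p ≡ advance (not s) j) ⊎ LinkOk (spikeRow b p) (spikeRow (not b) p′) j s
spikeRow-linkOk = from-yes (all-Bool? λ b → all? λ p → all? λ p′ → all? λ j → all-Bool? λ s →
  (p′ ≟ᶠ j ×-dec p ≟ᶠ advance (not s) j) ⊎-dec linkOk? (spikeRow b p) (spikeRow (not b) p′) j s)

spikeRow-closingOk : ∀ p p′ j → (p ≡ j × p′ ≡ j) ⊎ ClosingOk (spikeRow false p) (spikeRow true p′) j
spikeRow-closingOk = from-yes (all? λ p → all? λ p′ → all? λ j →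
  (p ≟ᶠ j ×-dec p′ ≟ᶠ j) ⊎-dec closingOk? (spikeRow false p) (spikeRow true p′) j)

spikeRow-linked-const : ∀ b → Linked (spikeRow b zero) (const (bit (not b)))
spikeRow-linked-const = from-yes (all-Bool? λ b → linked? (spikeRow b zero) (const (bit (not b))))

const-linked-spikeRow₂₃ : ∀ b b′ → Linked (const (bit b)) (spikeRow₂₃ b′)
const-linked-spikeRow₂₃ = from-yes (all-Bool? λ b → all-Bool? λ b′ → linked? (const (bit b)) (spikeRow₂₃ b′))

const-linked-3 : ∀ b → Linked (const (bit b)) (const 3)
const-linked-3 = from-yes (all-Bool? λ b → linked? (const (bit b)) (const 3))

spikeRow₂₃-bichromatic : ∀ b → BichromaticRow (spikeRow₂₃ b)
spikeRow₂₃-bichromatic = from-yes (all-Bool? λ b → bichromaticRow? (spikeRow₂₃ b))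

spikeRow₂₃-linked : ∀ b → Linked (spikeRow₂₃ b) (spikeRow₂₃ (not b))
spikeRow₂₃-linked = from-yes (all-Bool? λ b → linked? (spikeRow₂₃ b) (spikeRow₂₃ (not b)))

spikeRow₂₃-linked-3 : Linked (spikeRow₂₃ false) (const 3)
spikeRow₂₃-linked-3 = from-yes (linked? (spikeRow₂₃ false) (const 3))

spikeRow-closingOk-3 : ∀ j → ClosingOk (spikeRow false zero) (const 3) j
spikeRow-closingOk-3 = from-yes (all? λ j → closingOk? (spikeRow false zero) (const 3) j)

const-closingOk-3 : ∀ b j → ClosingOk (const (bit b)) (const 3) j
const-closingOk-3 = from-yes (all-Bool? λ b → all? λ j → closingOk? (const (bit b)) (const 3) j)

-- Hypergraph k is the hypergraph of the lemma for 2k + 2 blocks; the blocks are numbered from 0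

module Hypergraph (k : ℕ) where

  m : ℕ
  m = suc (k + k)

  open Construction m

  data Edge : Set where
    blockEdge   : Fin m → Edge
    linkEdge    : Fin m → Fin 3 → Bool → Edge
    closingEdge : Fin 3 → Edge

  edgeSet : Edge → Subset (K * 3)
  edgeSet (blockEdge q)    = block (inject₁ q)
  edgeSet (linkEdge q j s) = triple (v (suc q) j) (v (inject₁ q) j) (v (inject₁ q) (advance s j))
  edgeSet (closingEdge j)  = triple (v zero j) (v lastBlock (next3 j)) (v lastBlock (next3 (next3 j)))

  linkAt : Fin m → Fin 3 × Bool → Edge
  linkAt q js = linkEdge q (proj₁ js) (proj₂ js)

  offsets : List (Fin 3 × Bool)
  offsets = cartesianProduct (allFin 3) (false ∷ true ∷ [])

  allBlocks allLinks allClosings allEdges : List Edge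
  allBlocks   = map blockEdge (allFin m)
  allLinks    = cartesianProductWith linkAt (allFin m) offsets
  allClosings = map closingEdge (allFin 3)
  allEdges    = allBlocks ++ allLinks ++ allClosings

  edges≡ : edges H ≡ map edgeSet allEdges
  edges≡ = begin
    blockEdges ++ linkEdges ++ closingEdges
      ≡⟨ cong₂ _++_ (map-∘ {g = edgeSet} {f = blockEdge} (allFin m))
                    (cong₂ _++_ (concatMap-cartesianProductWith edgeSet linkAt offsets (λ _ → refl) (allFin m))
                                (map-∘ {g = edgeSet} {f = closingEdge} (allFin 3))) ⟩
    map edgeSet allBlocks ++ map edgeSet allLinks ++ map edgeSet allClosings
      ≡⟨ cong (map edgeSet allBlocks ++_) (sym (map-++ edgeSet allLinks allClosings)) ⟩
    map edgeSet allBlocks ++ map edgeSet (allLinks ++ allClosings)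
      ≡⟨ sym (map-++ edgeSet allBlocks (allLinks ++ allClosings)) ⟩
    map edgeSet allEdges ∎
    where open ≡-Reasoning

  H′ : BiHypergraph (K * 3)
  H′ = record { edges = map edgeSet allEdges }

  allEdges-unique : Unique allEdges
  allEdges-unique = ++⁺ (map⁺ {f = blockEdge} (λ { refl → refl }) (allFin⁺ m))
                        (++⁺ (cartesianProductWith⁺ linkAt (λ { refl → refl , refl }) (allFin⁺ m)
                                                    (cartesianProduct⁺ (allFin⁺ 3) (((λ ()) ∷ []) ∷ [] ∷ [])))
                             (map⁺ {f = closingEdge} (λ { refl → refl }) (allFin⁺ 3))
                             links#closings)
                        blocks#rest
    where
    links#closings : ∀ {d} → ¬ (d ∈ allLinks × d ∈ allClosings)
    links#closings (d∈links , d∈closings)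
      with ∈-cartesianProductWith⁻ linkAt (allFin m) offsets d∈links | ∈-map⁻ closingEdge d∈closings
    ... | _ , _ , _ , _ , refl | _ , _ , ()
    blocks#rest : ∀ {d} → ¬ (d ∈ allBlocks × d ∈ allLinks ++ allClosings)
    blocks#rest (d∈blocks , d∈rest) with ∈-map⁻ blockEdge d∈blocks | ∈-++⁻ allLinks d∈rest
    ... | _ , _ , refl | inj₁ d∈links with ∈-cartesianProductWith⁻ linkAt (allFin m) offsets d∈links
    ...   | _ , _ , _ , _ , ()
    blocks#rest _ | _ , _ , refl | inj₂ d∈closings with ∈-map⁻ closingEdge d∈closings
    ...   | _ , _ , ()

  ∈-allEdges : ∀ d → d ∈ allEdges
  ∈-allEdges (blockEdge q)    = ∈-++⁺ˡ (∈-map⁺ blockEdge (∈-allFin q))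
  ∈-allEdges (linkEdge q j s) = ∈-++⁺ʳ allBlocks (∈-++⁺ˡ (∈-cartesianProductWith⁺ linkAt (∈-allFin q)
                                  (∈-cartesianProduct⁺ (∈-allFin j) (∈-bools s))))
    where
    ∈-bools : ∀ s → s ∈ false ∷ true ∷ []
    ∈-bools false = here refl
    ∈-bools true  = there (here refl)
  ∈-allEdges (closingEdge j)  = ∈-++⁺ʳ allBlocks (∈-++⁺ʳ allLinks (∈-map⁺ closingEdge (∈-allFin j)))

  edgeSet-listed : ∀ d → ∃ λ i → edge H′ i ≡ edgeSet d
  edgeSet-listed d = ∈⇒lookup (∈-map⁺ edgeSet (∈-allEdges d))

  EdgeOk : (ℕ → Row) → Edge → Set
  EdgeOk c (blockEdge q)    = BichromaticRow (c (toℕ q))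
  EdgeOk c (linkEdge q j s) = LinkOk (c (toℕ q)) (c (suc (toℕ q))) j s
  EdgeOk c (closingEdge j)  = ClosingOk (c 0) (c m) j

  Represents : (Fin (K * 3) → ℕ) → (ℕ → Row) → Set
  Represents f c = ∀ i j → f (v i j) ≡ c (toℕ i) j

  v-≢ : ∀ i j i′ j′ → i ≢ i′ ⊎ j ≢ j′ → v i j ≢ v i′ j′
  v-≢ i j i′ j′ (inj₁ i≢i′) = i≢i′ ∘ combine-injectiveˡ i j i′ j′
  v-≢ i j i′ j′ (inj₂ j≢j′) = j≢j′ ∘ combine-injectiveʳ i j i′ j′

  suc≢inject₁ : (q : Fin m) → suc q ≢ inject₁ q
  suc≢inject₁ q e = 1+n≢n (trans (cong toℕ e) (toℕ-inject₁ q))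

  module _ {f c} (f≈c : Represents f c) where

    represents-inject₁ : ∀ q j → f (v (inject₁ q) j) ≡ c (toℕ q) j
    represents-inject₁ q j = trans (f≈c (inject₁ q) j) (cong (λ t → c t j) (toℕ-inject₁ q))

    represents-last : ∀ j → f (v lastBlock j) ≡ c m j
    represents-last j = trans (f≈c lastBlock j) (cong (λ t → c t j) (toℕ-fromℕ m))

    proper⇔edgeOk : ∀ d → ProperOnEdge f (edgeSet d) ⇔ EdgeOk c d
    proper⇔edgeOk (blockEdge q) =
      ⇔.trans (properOnTriple⇔ f (v-≢ i _ i _ (inj₂ λ ())) (v-≢ i _ i _ (inj₂ λ ())) (v-≢ i _ i _ (inj₂ λ ())))
              (bichromatic-cong (represents-inject₁ q _) (represents-inject₁ q _) (represents-inject₁ q _))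
      where i = inject₁ q
    proper⇔edgeOk (linkEdge q j s) =
      ⇔.trans (properOnTriple⇔ f (v-≢ (suc q) j i j (inj₁ (suc≢inject₁ q)))
                                 (v-≢ (suc q) j i _ (inj₁ (suc≢inject₁ q)))
                                 (v-≢ i j i _ (inj₂ (advance-≢ s j ∘ sym))))
              (bichromatic-cong (f≈c (suc q) j) (represents-inject₁ q j) (represents-inject₁ q _))
      where i = inject₁ q
    proper⇔edgeOk (closingEdge j) =
      ⇔.trans (properOnTriple⇔ f (v-≢ zero j lastBlock _ (inj₁ λ ()))
                                 (v-≢ zero j lastBlock _ (inj₁ λ ()))
                                 (v-≢ lastBlock (next3 j) lastBlock (next3 (next3 j))
                                      (inj₂ ((λ ()) ∘ advance-injective j false true))))
              (bichromatic-cong (f≈c zero j) (represents-last _) (represents-last _))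

  -- row t of f is block min t m; rows beyond m are never looked at
  rowsOf : (Fin (K * 3) → ℕ) → ℕ → Row
  rowsOf f t j = f (v (fromℕ< (s≤s (m⊓n≤n t m))) j)

  rowsOf-represents : ∀ f → Represents f (rowsOf f)
  rowsOf-represents f i j = cong (λ i′ → f (v i′ j)) (sym (trans
    (fromℕ<-cong _ _ (m≤n⇒m⊓n≡m (s≤s⁻¹ (toℕ<n i))) _ (toℕ<n i)) (fromℕ<-toℕ i _)))

  fromRows : (ℕ → Row) → Fin (K * 3) → ℕ
  fromRows c x = c (toℕ (proj₁ (remQuot {K} 3 x))) (proj₂ (remQuot {K} 3 x))

  fromRows-represents : ∀ c → Represents (fromRows c) c
  fromRows-represents c i j = cong (λ (i′ , j′) → c (toℕ i′) j′) (remQuot-combine {K} {3} i j)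

  uncolourable : ¬ Colourable H′
  uncolourable (f , proper) = chain-uncolourable k c blocks links (λ j → edgeOk (closingEdge j))
    where
    c = rowsOf f
    edgeOk : ∀ d → EdgeOk c d
    edgeOk d with edgeSet-listed d
    ... | i , eᵢ≡ = Equivalence.to (proper⇔edgeOk (rowsOf-represents f) d)
                                   (subst (ProperOnEdge f) eᵢ≡ (proper i))
    blocks : ∀ {t} → t < m → BichromaticRow (c t)
    blocks t<m = subst (BichromaticRow ∘ c) (toℕ-fromℕ< t<m) (edgeOk (blockEdge (fromℕ< t<m)))
    links : ∀ {t} → t < m → Linked (c t) (c (suc t))
    links t<m j s = subst (λ t → LinkOk (c t) (c (suc t)) j s) (toℕ-fromℕ< t<m)
                          (edgeOk (linkEdge (fromℕ< t<m) j s))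

  edge-containing : ∀ {x} d → x Subset.∈ edgeSet d → ∃ λ e → x Subset.∈ edge H′ e
  edge-containing d x∈d with edgeSet-listed d
  ... | e , eₑ≡ = e , subst (_ Subset.∈_) (sym eₑ≡) x∈d

  vertex-covered : ∀ i j → ∃ λ e → v i j Subset.∈ edge H′ e
  vertex-covered zero    j = edge-containing (closingEdge j) (x∈p∪q⁺ (inj₁ (x∈⁅x⁆ _)))
  vertex-covered (suc q) j = edge-containing (linkEdge q j false) (x∈p∪q⁺ (inj₁ (x∈⁅x⁆ _)))

  covered : ∀ x → ∃ λ e → x Subset.∈ edge H′ e
  covered x = subst (λ y → ∃ λ e → y Subset.∈ edge H′ e) (combine-remQuot {K} 3 x)
                    (uncurry vertex-covered (remQuot {K} 3 x))

  spikes : (ℕ → Fin 3) → ℕ → Row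
  spikes p t = spikeRow (odd t) (p t)

  spikes-closing : ∀ p j → (p 0 ≡ j × p m ≡ j) ⊎ EdgeOk (spikes p) (closingEdge j)
  spikes-closing p j = subst (λ b → (p 0 ≡ j × p m ≡ j) ⊎ ClosingOk (spikeRow false (p 0)) (spikeRow b (p m)) j)
                             (sym (cong not (odd-double k))) (spikeRow-closingOk (p 0) (p m) j)

  without-closing : ∀ j₀ d → d ≢ closingEdge j₀ → EdgeOk (spikes (const j₀)) d
  without-closing j₀ (blockEdge q)    _   = spikeRow-bichromatic (odd (toℕ q)) j₀
  without-closing j₀ (linkEdge q j s) _   = spikeRow-linked (odd (toℕ q)) j₀ j s
  without-closing j₀ (closingEdge j)  d≢ =
    fromInj₂ (λ (j₀≡j , _) → ⊥-elim (d≢ (cong closingEdge (sym j₀≡j)))) (spikes-closing (const j₀) j)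

  module WithoutLink (q₀ : Fin m) (j₀ : Fin 3) (s₀ : Bool) where

    switch : ℕ → Fin 3
    switch t = if does (t ≤? toℕ q₀) then advance (not s₀) j₀ else j₀

    switch-≤ : ∀ {t} → t ≤ toℕ q₀ → switch t ≡ advance (not s₀) j₀
    switch-≤ {t} t≤q₀ rewrite dec-true (t ≤? toℕ q₀) t≤q₀ = refl

    switch-> : ∀ {t} → toℕ q₀ < t → switch t ≡ j₀
    switch-> {t} q₀<t rewrite dec-false (t ≤? toℕ q₀) (<⇒≱ q₀<t) = refl

    switch-step : ∀ {t} → t ≢ toℕ q₀ → switch t ≡ switch (suc t)
    switch-step {t} t≢q₀ with <-cmp t (toℕ q₀)
    ... | tri< t<q₀ _ _ = trans (switch-≤ (<⇒≤ t<q₀)) (sym (switch-≤ t<q₀))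
    ... | tri≈ _ t≡q₀ _ = ⊥-elim (t≢q₀ t≡q₀)
    ... | tri> _ _ q₀<t = trans (switch-> q₀<t) (sym (switch-> (m<n⇒m<1+n q₀<t)))

    without : ∀ d → d ≢ linkEdge q₀ j₀ s₀ → EdgeOk (spikes switch) d
    without (blockEdge q)    _  = spikeRow-bichromatic (odd (toℕ q)) (switch (toℕ q))
    without (linkEdge q j s) d≢ =
      fromInj₂ excluded (spikeRow-linkOk (odd (toℕ q)) (switch (toℕ q)) (switch (suc (toℕ q))) j s)
      where
      excluded : switch (suc (toℕ q)) ≡ j × switch (toℕ q) ≡ advance (not s) j →
                 EdgeOk (spikes switch) (linkEdge q j s)
      excluded (e₁ , e₂) with toℕ q ≟ toℕ q₀
      ... | no q≢q₀ = ⊥-elim (advance-≢ (not s) j (trans (sym e₂) (trans (switch-step q≢q₀) e₁)))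
      ... | yes q≡q₀ with toℕ-injective q≡q₀ | trans (sym (switch-> (s≤s (≤-reflexive (sym q≡q₀))))) e₁
      ...   | refl | refl = ⊥-elim (d≢ (cong (linkEdge q₀ j₀)
                (not-injective (advance-injective j₀ _ _ (trans (sym e₂) (switch-≤ (≤-reflexive q≡q₀)))))))
    without (closingEdge j)  _  = fromInj₂ excluded (spikes-closing switch j)
      where
      excluded : switch 0 ≡ j × switch m ≡ j → EdgeOk (spikes switch) (closingEdge j)
      excluded (e₀ , eₘ) = ⊥-elim (advance-≢ (not s₀) j₀
        (trans (sym (switch-≤ z≤n)) (trans e₀ (trans (sym eₘ) (switch-> (toℕ<n q₀))))))

  module WithoutBlock (σ′ : Fin m) where

    σ : ℕ
    σ = toℕ σ′

    gapRows : ℕ → Row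
    gapRows t = if does (t <? σ) then spikeRow (odd t) zero
                else if does (t ≟ σ) then const (bit (odd t))
                else if does (t <? m) then spikeRow₂₃ (odd t)
                else const 3

    gap-< : ∀ {t} → t < σ → gapRows t ≡ spikeRow (odd t) zero
    gap-< {t} t<σ rewrite dec-true (t <? σ) t<σ = refl

    gap-≡ : ∀ {t} → t ≡ σ → gapRows t ≡ const (bit (odd t))
    gap-≡ {t} refl rewrite dec-false (t <? t) (n≮n t) | dec-true (t ≟ t) refl = refl

    gap-> : ∀ {t} → σ < t → t < m → gapRows t ≡ spikeRow₂₃ (odd t)
    gap-> {t} σ<t t<m rewrite dec-false (t <? σ) (<⇒≯ σ<t) | dec-false (t ≟ σ) (>⇒≢ σ<t)
                            | dec-true (t <? m) t<m = refl

    gap-≥m : ∀ {t} → m ≤ t → gapRows t ≡ const 3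
    gap-≥m {t} m≤t rewrite dec-false (t <? σ) (<⇒≯ (<-≤-trans (toℕ<n σ′) m≤t))
                         | dec-false (t ≟ σ) (>⇒≢ (<-≤-trans (toℕ<n σ′) m≤t))
                         | dec-false (t <? m) (≤⇒≯ m≤t) = refl

    gap-linked : ∀ {t} → t < m → Linked (gapRows t) (gapRows (suc t))
    gap-linked {t} t<m with <-cmp t σ
    ... | tri< t<σ _ _ with m≤n⇒m<n∨m≡n t<σ
    ...   | inj₁ 1+t<σ rewrite gap-< t<σ | gap-< 1+t<σ = spikeRow-linked (odd t) zero
    ...   | inj₂ 1+t≡σ rewrite gap-< t<σ | gap-≡ 1+t≡σ = spikeRow-linked-const (odd t)
    gap-linked {t} t<m | tri≈ _ t≡σ _ with m≤n⇒m<n∨m≡n t<m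
    ...   | inj₁ 1+t<m rewrite gap-≡ t≡σ | gap-> (s≤s (≤-reflexive (sym t≡σ))) 1+t<m =
      const-linked-spikeRow₂₃ (odd t) (not (odd t))
    ...   | inj₂ 1+t≡m rewrite gap-≡ t≡σ | gap-≥m (≤-reflexive (sym 1+t≡m)) = const-linked-3 (odd t)
    gap-linked {t} t<m | tri> _ _ σ<t with m≤n⇒m<n∨m≡n t<m
    ...   | inj₁ 1+t<m rewrite gap-> σ<t t<m | gap-> (m<n⇒m<1+n σ<t) 1+t<m = spikeRow₂₃-linked (odd t)
    ...   | inj₂ 1+t≡m rewrite gap-> σ<t t<m | gap-≥m (≤-reflexive (sym 1+t≡m))
                             | trans (cong odd (suc-injective 1+t≡m)) (odd-double k) = spikeRow₂₃-linked-3

    gap-closing : ∀ j → ClosingOk (gapRows 0) (gapRows m) j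
    gap-closing j rewrite gap-≥m (≤-refl {m}) with m≤n⇒m<n∨m≡n (z≤n {σ})
    ... | inj₁ 0<σ rewrite gap-< 0<σ = spikeRow-closingOk-3 j
    ... | inj₂ 0≡σ rewrite gap-≡ 0≡σ = const-closingOk-3 false j

    without : ∀ d → d ≢ blockEdge σ′ → EdgeOk gapRows d
    without (blockEdge q) d≢ with <-cmp (toℕ q) σ
    ... | tri< q<σ _ _ rewrite gap-< q<σ = spikeRow-bichromatic (odd (toℕ q)) zero
    ... | tri≈ _ q≡σ _ = ⊥-elim (d≢ (cong blockEdge (toℕ-injective q≡σ)))
    ... | tri> _ _ σ<q rewrite gap-> σ<q (toℕ<n q) = spikeRow₂₃-bichromatic (odd (toℕ q))
    without (linkEdge q j s) _ = gap-linked (toℕ<n q) j s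
    without (closingEdge j)  _ = gap-closing j

  rowsWithout : ∀ d₀ → Σ (ℕ → Row) λ c → ∀ d → d ≢ d₀ → EdgeOk c d
  rowsWithout (blockEdge σ)       = WithoutBlock.gapRows σ , WithoutBlock.without σ
  rowsWithout (linkEdge q₀ j₀ s₀) = spikes (WithoutLink.switch q₀ j₀ s₀) , WithoutLink.without q₀ j₀ s₀
  rowsWithout (closingEdge j₀)    = spikes (const j₀) , without-closing j₀

  critical : ∀ i₀ → Σ (Fin (K * 3) → ℕ) λ f → ∀ i → i ≢ i₀ → ProperOnEdge f (edge H′ i)
  critical = except-lookup-map edgeSet ProperOnEdge allEdges-unique λ d₀ →
    let c , ok = rowsWithout d₀
    in fromRows c , λ d d≢d₀ → Equivalence.from (proper⇔edgeOk (fromRows-represents c) d) (ok d d≢d₀)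

  minimalUncolourable : MinimalUncolourable H
  minimalUncolourable = subst MinimalUncolourable (cong (λ es → record { edges = es }) (sym edges≡))
                              (minimalUncolourable-intro uncolourable covered critical)

lemma4p1 : (k : ℕ) → 1 ≤ k → MinimalUncolourable (Hlemma k)
lemma4p1 (suc k) _ = subst (MinimalUncolourable ∘ Construction.H) m≡2k∸1 (Hypergraph.minimalUncolourable k)
  where
  m≡2k∸1 : suc (k + k) ≡ 2 * suc k ∸ 1
  m≡2k∸1 = sym (trans (+-suc k (k + 0)) (cong (λ x → suc (k + x)) (+-identityʳ k)))
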